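{- Let $w=\frac{az+b}{cz+d}$ be a PLFT with $c\neq0$, $d\neq0$ and $ad-bc=\pm1$. Let $s\ge0$, let $q_0$ be a nonnegative integer, and let $q_1,\dots,q_{s+1}$ be positive integers. Suppose that $$\frac{a}{c}=[q_0,q_1,\ldots,q_{s+1}]\quad\text{and}\quad \frac{b}{d}=[q_0,q_1,\ldots,q_s].$$ Then $$w=[q_0,q_1,\ldots,q_{s+1},z]=q_0+\cfrac{1}{q_1+\cfrac{1}{\ddots+\cfrac{1}{q_{s+1}+\frac{1}{z}}}},$$ and the orphan root of $w$ is $z^{(-1)^s}$; that is, it is $z$ if $s$ is even and $1/z$ if $s$ is odd.
   Context: A positive linear fractional transformation (PLFT) is $\frac{az+b}{cz+d}$ with $a,b,c,d$ nonnegative integers and $ad-bc\neq0$. PLFTs are identified with their coefficient matrices. For a PLFT $f$, define $L(f)=f/(f+1)$ and $R(f)=f+1$. A PLFT is an orphan if it is not of the form $L(f)$ or $R(f)$ for any PLFT $f$. It is a known fact that every PLFT $w$ is obtained from a unique orphan PLFT $g$ by applying finitely many (possibly zero) of the maps $L$ and $R$; this $g$ is called the orphan root of $w$. For a nonnegative integer $q_0$ and positive integers $q_1,\dots,q_n$, $$[q_0,q_1,\dots,q_n]=q_0+\cfrac{1}{q_1+\cfrac{1}{\ddots+\cfrac{1}{q_n}}}.$$ When the last entry is a PLFT, the same notation is used. -}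

module Defs where

open import Data.Nat using (ℕ; zero; suc; _+_; _*_)
open import Data.Product using (_×_; _,_; Σ; ∃)
open import Data.List using (List; []; _∷_)
open import Data.Bool using (Bool; true; false)
open import Relation.Binary.PropositionalEquality using (_≡_; _≢_)
open import Relation.Nullary using (¬_)
open import Data.Sum using (_⊎_)

-- Coefficient matrix (a b / c d) of (a z + b)/(c z + d), entries in ℕ.
-- PLFTs are identified with their coefficient matrices, so equality of
-- PLFTs is (propositional) equality of these records.
record Mat : Set where
  constructor mat
  field
    a b c d : ℕ
open Mat public

IsPLFT : Mat → Set
IsPLFT m = a m * d m ≢ b m * c m

-- L(f) = f/(f+1)  :  (az+b)/((a+c)z+(b+d))
Lmap : Mat → Mat
Lmap (mat a b c d) = mat a b (a + c) (b + d)

-- R(f) = f + 1    :  ((a+c)z+(b+d))/(cz+d)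
Rmap : Mat → Mat
Rmap (mat a b c d) = mat (a + c) (b + d) c d

Orphan : Mat → Set
Orphan g = IsPLFT g × ¬ (Σ Mat λ f → IsPLFT f × (g ≡ Lmap f ⊎ g ≡ Rmap f))

-- Apply a finite word in L (true) and R (false); the head is applied last.
applyWord : List Bool → Mat → Mat
applyWord [] g = g
applyWord (true ∷ ws) g = Lmap (applyWord ws g)
applyWord (false ∷ ws) g = Rmap (applyWord ws g)

-- g is the orphan root of w: g is an orphan and w is obtained from g by
-- finitely many applications of L and R (uniqueness is the known fact).
OrphanRoot : Mat → Mat → Set
OrphanRoot g w = Orphan g × ∃ λ ws → w ≡ applyWord ws g

zId : Mat
zId = mat 1 0 0 1

zInv : Mat
zInv = mat 0 1 1 0

zPow : ℕ → Mat
zPow zero = zId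
zPow (suc zero) = zInv
zPow (suc (suc n)) = zPow n

-- q + 1/f for a PLFT f = (az+b)/(cz+d):  ((qa+c)z + (qb+d))/(az+b)
plusInv : ℕ → Mat → Mat
plusInv q (mat a b c d) = mat (q * a + c) (q * b + d) a b

cfPLFT : ℕ → List ℕ → Mat → Mat
cfPLFT q [] f = plusInv q f
cfPLFT q (x ∷ xs) f = plusInv q (cfPLFT x xs f)

-- value of [q0, q1, ..., qn] as a fraction (numerator , denominator):
-- [q] = q/1 ;  [q, rest] = q + 1/(p/r) = (q p + r)/p  where rest = p/r
cfFrac : ℕ → List ℕ → ℕ × ℕ
cfFrac q [] = q , 1
cfFrac q (x ∷ xs) with cfFrac x xs
... | p , r = q * p + r , p

_≐_ : ℕ × ℕ → ℕ × ℕ → Set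
(x , y) ≐ (p , r) = x * r ≡ p * y

-- The matrix of [q₀, …, qₛ₊₁, z] has the two last convergents of [q₀, …, qₛ₊₁]
-- as its columns and determinant ±1, so its columns are reduced fractions; a
-- unimodular w with the same column values is therefore this very matrix.
-- Each step q + 1/f is R^q applied to f with its rows swapped, and swapping
-- rows commutes with words in L, R up to exchanging L and R; hence the matrix
-- is a word applied to the identity with its rows swapped s + 2 times, i.e.
-- to z^((-1)^s). That is an orphan because L f has its bottom row entrywise
-- at least its top row and R f the reverse.
module Submission where

open import Defs
open import Data.Nat using (ℕ; zero; suc; _+_; _*_; _<_; z<s; ≢-nonZero)
open import Data.Nat.Properties
  using (+-comm; +-assoc; +-identityʳ; *-identityʳ; *-zeroʳ; *-cancelʳ-≡; <⇒≱; m≤m+n; m≤n+m)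
open import Data.Nat.Divisibility using (_∣_; ∣-trans; ∣-antisym; m∣m*n; n∣m*n; ∣m+n∣m⇒∣n; ∣1⇒≡1)
open import Data.Nat.Coprimality using (Coprime; coprime-divisor) renaming (sym to Coprime-sym)
open import Data.Nat.Tactic.RingSolver using (solve-∀)
open import Data.Product using (_×_; _,_; proj₁; proj₂)
open import Data.Sum using (_⊎_; inj₁; inj₂)
import Data.Sum as Sum
open import Data.Bool using (Bool; true; false; not)
open import Function using (_∘_)
open import Data.List using (List; []; _∷_; _++_; [_]; length; replicate; map)
open import Data.Vec using (Vec; toList; _∷ʳ_)
open import Data.Vec.Properties using (toList-∷ʳ; length-toList)
open import Data.List.Relation.Unary.All using (All)
open import Relation.Binary.PropositionalEquality
  using (_≡_; _≢_; refl; sym; trans; cong; cong₂; subst; subst₂; module ≡-Reasoning)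

OneApart : ℕ → ℕ → Set
OneApart x y = x ≡ y + 1 ⊎ y ≡ x + 1

OneApart-+ˡ : ∀ k {x y} → OneApart x y → OneApart (k + x) (k + y)
OneApart-+ˡ k {x} {y} (inj₁ e) = inj₁ (trans (cong (k +_) e) (sym (+-assoc k y 1)))
OneApart-+ˡ k {x} {y} (inj₂ e) = inj₂ (trans (cong (k +_) e) (sym (+-assoc k x 1)))

OneApart⇒common-divisor-∣1 : ∀ {i x y} → i ∣ x → i ∣ y → OneApart x y → i ∣ 1
OneApart⇒common-divisor-∣1 i∣x i∣y (inj₁ e) = ∣m+n∣m⇒∣n (subst (_ ∣_) e i∣x) i∣y
OneApart⇒common-divisor-∣1 i∣x i∣y (inj₂ e) = ∣m+n∣m⇒∣n (subst (_ ∣_) e i∣y) i∣x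

Unimodular : Mat → Set
Unimodular m = OneApart (a m * d m) (b m * c m)

unimodular⇒coprime-a-c : ∀ m → Unimodular m → Coprime (a m) (c m)
unimodular⇒coprime-a-c (mat a b c d) u (i∣a , i∣c) =
  ∣1⇒≡1 (OneApart⇒common-divisor-∣1 (∣-trans i∣a (m∣m*n d)) (∣-trans i∣c (n∣m*n b)) u)

unimodular⇒coprime-b-d : ∀ m → Unimodular m → Coprime (b m) (d m)
unimodular⇒coprime-b-d (mat a b c d) u = unimodular⇒coprime-a-c (mat b a d c) (Sum.swap u)

coprime-≐⇒≡ : ∀ {x y p r} → Coprime x y → Coprime p r → y ≢ 0 →
  (x , y) ≐ (p , r) → x ≡ p × y ≡ r
coprime-≐⇒≡ {x} {y} {p} {r} x⊥y p⊥r y≢0 e = x≡p , y≡r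
  where
  y≡r : y ≡ r
  y≡r = ∣-antisym
    (coprime-divisor (Coprime-sym x⊥y) (subst (y ∣_) (sym e) (n∣m*n p)))
    (coprime-divisor (Coprime-sym p⊥r) (subst (r ∣_) e (n∣m*n x)))
  x≡p : x ≡ p
  x≡p = *-cancelʳ-≡ x p y {{≢-nonZero y≢0}} (trans (cong (x *_) y≡r) e)

unimodular-≐-columns⇒≡ : ∀ {m n} → Unimodular m → Unimodular n → c m ≢ 0 → d m ≢ 0 →
  (a m , c m) ≐ (a n , c n) → (b m , d m) ≐ (b n , d n) → m ≡ n
unimodular-≐-columns⇒≡ {m@(mat a b c d)} {n@(mat a′ b′ c′ d′)} um un c≢0 d≢0 ac≐ bd≐
  with coprime-≐⇒≡ (unimodular⇒coprime-a-c m um) (unimodular⇒coprime-a-c n un) c≢0 ac≐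
     | coprime-≐⇒≡ (unimodular⇒coprime-b-d m um) (unimodular⇒coprime-b-d n un) d≢0 bd≐
... | refl , refl | refl , refl = refl

plusInv-unimodular : ∀ q m → Unimodular m → Unimodular (plusInv q m)
plusInv-unimodular q (mat a b c d) u =
  subst₂ OneApart (sym (expandˡ q a b c)) (sym (expandʳ q a b d))
    (OneApart-+ˡ (q * a * b) (Sum.swap u))
  where
  expandˡ : ∀ q a b c → (q * a + c) * b ≡ q * a * b + b * c
  expandˡ = solve-∀
  expandʳ : ∀ q a b d → (q * b + d) * a ≡ q * a * b + a * d
  expandʳ = solve-∀

cfPLFT-unimodular : ∀ q xs → Unimodular (cfPLFT q xs zId)
cfPLFT-unimodular q [] = plusInv-unimodular q zId (inj₁ refl)
cfPLFT-unimodular q (x ∷ xs) = plusInv-unimodular q _ (cfPLFT-unimodular x xs)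

cfPLFT-columns : ∀ q xs ql → cfPLFT q (xs ++ [ ql ]) zId ≡
  mat (proj₁ (cfFrac q (xs ++ [ ql ]))) (proj₁ (cfFrac q xs))
      (proj₂ (cfFrac q (xs ++ [ ql ]))) (proj₂ (cfFrac q xs))
cfPLFT-columns q [] ql
  rewrite *-identityʳ ql | *-zeroʳ ql | +-identityʳ ql | *-identityʳ q | +-identityʳ q = refl
cfPLFT-columns q (x ∷ xs) ql rewrite cfPLFT-columns x xs ql = refl

swapRows : Mat → Mat
swapRows (mat a b c d) = mat c d a b

swapRows-Lmap : ∀ m → swapRows (Lmap m) ≡ Rmap (swapRows m)
swapRows-Lmap (mat a b c d) = cong₂ (λ x y → mat x y a b) (+-comm a c) (+-comm b d)

swapRows-Rmap : ∀ m → swapRows (Rmap m) ≡ Lmap (swapRows m)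
swapRows-Rmap (mat a b c d) = cong₂ (λ x y → mat c d x y) (+-comm a c) (+-comm b d)

swapRows-applyWord : ∀ ws m → swapRows (applyWord ws m) ≡ applyWord (map not ws) (swapRows m)
swapRows-applyWord [] m = refl
swapRows-applyWord (true ∷ ws) m =
  trans (swapRows-Lmap (applyWord ws m)) (cong Rmap (swapRows-applyWord ws m))
swapRows-applyWord (false ∷ ws) m =
  trans (swapRows-Rmap (applyWord ws m)) (cong Lmap (swapRows-applyWord ws m))

swapRows-zPow : ∀ k → swapRows (zPow k) ≡ zPow (suc k)
swapRows-zPow zero = refl
swapRows-zPow (suc zero) = refl
swapRows-zPow (suc (suc k)) = swapRows-zPow k

applyWord-++ : ∀ us ws m → applyWord (us ++ ws) m ≡ applyWord us (applyWord ws m)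
applyWord-++ [] ws m = refl
applyWord-++ (true ∷ us) ws m = cong Lmap (applyWord-++ us ws m)
applyWord-++ (false ∷ us) ws m = cong Rmap (applyWord-++ us ws m)

plusInv-suc : ∀ q m → plusInv (suc q) m ≡ Rmap (plusInv q m)
plusInv-suc q (mat a b c d) = cong₂ (λ x y → mat x y a b) (shift a c) (shift b d)
  where
  shift : ∀ x z → x + q * x + z ≡ q * x + z + x
  shift x z = trans (+-assoc x (q * x) z) (+-comm x (q * x + z))

plusInv≡R^q∘swapRows : ∀ q m → plusInv q m ≡ applyWord (replicate q false) (swapRows m)
plusInv≡R^q∘swapRows zero (mat a b c d) = refl
plusInv≡R^q∘swapRows (suc q) m = trans (plusInv-suc q m) (cong Rmap (plusInv≡R^q∘swapRows q m))

-- The word R^q₀ L^q₁ R^q₂ ⋯ of the continued fraction.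
cfWord : ℕ → List ℕ → List Bool
cfWord q [] = replicate q false
cfWord q (x ∷ xs) = replicate q false ++ map not (cfWord x xs)

cfPLFT≡applyWord-cfWord : ∀ q xs → cfPLFT q xs zId ≡ applyWord (cfWord q xs) (zPow (suc (length xs)))
cfPLFT≡applyWord-cfWord q [] = plusInv≡R^q∘swapRows q zId
cfPLFT≡applyWord-cfWord q (x ∷ xs) = begin
  plusInv q (cfPLFT x xs zId)
    ≡⟨ plusInv≡R^q∘swapRows q _ ⟩
  applyWord Rq (swapRows (cfPLFT x xs zId))
    ≡⟨ cong (applyWord Rq ∘ swapRows) (cfPLFT≡applyWord-cfWord x xs) ⟩
  applyWord Rq (swapRows (applyWord (cfWord x xs) (zPow (suc (length xs)))))
    ≡⟨ cong (applyWord Rq) (swapRows-applyWord (cfWord x xs) _) ⟩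
  applyWord Rq (applyWord (map not (cfWord x xs)) (swapRows (zPow (suc (length xs)))))
    ≡⟨ cong (applyWord Rq ∘ applyWord (map not (cfWord x xs))) (swapRows-zPow (suc (length xs))) ⟩
  applyWord Rq (applyWord (map not (cfWord x xs)) (zPow (suc (suc (length xs)))))
    ≡⟨ applyWord-++ Rq (map not (cfWord x xs)) _ ⟨
  applyWord (cfWord q (x ∷ xs)) (zPow (suc (length (x ∷ xs)))) ∎
  where
  open ≡-Reasoning
  Rq : List Bool
  Rq = replicate q false

row₂<row₁⇒≢Lmap : ∀ {g} f → (c g < a g ⊎ d g < b g) → g ≢ Lmap f
row₂<row₁⇒≢Lmap (mat a b c d) (inj₁ c<a) refl = <⇒≱ c<a (m≤m+n a c)
row₂<row₁⇒≢Lmap (mat a b c d) (inj₂ d<b) refl = <⇒≱ d<b (m≤m+n b d)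

row₁<row₂⇒≢Rmap : ∀ {g} f → (a g < c g ⊎ b g < d g) → g ≢ Rmap f
row₁<row₂⇒≢Rmap (mat a b c d) (inj₁ a<c) refl = <⇒≱ a<c (m≤n+m c a)
row₁<row₂⇒≢Rmap (mat a b c d) (inj₂ b<d) refl = <⇒≱ b<d (m≤n+m d b)

orphan-criterion : ∀ g → IsPLFT g → (c g < a g ⊎ d g < b g) → (a g < c g ⊎ b g < d g) → Orphan g
orphan-criterion g g-plft not-L not-R = g-plft , λ
  { (f , _ , inj₁ g≡Lf) → row₂<row₁⇒≢Lmap f not-L g≡Lf
  ; (f , _ , inj₂ g≡Rf) → row₁<row₂⇒≢Rmap f not-R g≡Rf
  }

zPow-orphan : ∀ s → Orphan (zPow s)
zPow-orphan zero = orphan-criterion zId (λ ()) (inj₁ z<s) (inj₂ z<s)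
zPow-orphan (suc zero) = orphan-criterion zInv (λ ()) (inj₂ z<s) (inj₁ z<s)
zPow-orphan (suc (suc s)) = zPow-orphan s

corollary3p6 : (a b c d : ℕ) → IsPLFT (mat a b c d) → c ≢ 0 → d ≢ 0 →
    (a * d ≡ b * c + 1 ⊎ b * c ≡ a * d + 1) →
    (s q0 : ℕ) (qs : Vec ℕ s) (qlast : ℕ) →
    All (0 <_) (toList qs) → 0 < qlast →
    (a , c) ≐ cfFrac q0 (toList qs ++ (qlast ∷ [])) →
    (b , d) ≐ cfFrac q0 (toList qs) →
    (mat a b c d ≡ cfPLFT q0 (toList qs ++ (qlast ∷ [])) zId)
    × OrphanRoot (zPow s) (mat a b c d)
corollary3p6 a b c d _ c≢0 d≢0 w-unimodular s q0 qs ql _ _ ac≐ bd≐ =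
  w≡cf , zPow-orphan s , cfWord q0 xs , trans w≡cf cf≡word
  where
  xs : List ℕ
  xs = toList qs ++ [ ql ]
  columns : cfPLFT q0 xs zId ≡ mat (proj₁ (cfFrac q0 xs)) (proj₁ (cfFrac q0 (toList qs)))
                                   (proj₂ (cfFrac q0 xs)) (proj₂ (cfFrac q0 (toList qs)))
  columns = cfPLFT-columns q0 (toList qs) ql
  w≡cf : mat a b c d ≡ cfPLFT q0 xs zId
  w≡cf = trans
    (unimodular-≐-columns⇒≡ w-unimodular (subst Unimodular columns (cfPLFT-unimodular q0 xs))
      c≢0 d≢0 ac≐ bd≐)
    (sym columns)
  length-xs : length xs ≡ suc s
  length-xs = trans (cong length (sym (toList-∷ʳ ql qs))) (length-toList (qs ∷ʳ ql))
  cf≡word : cfPLFT q0 xs zId ≡ applyWord (cfWord q0 xs) (zPow s)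
  cf≡word = subst (λ k → cfPLFT q0 xs zId ≡ applyWord (cfWord q0 xs) (zPow k))
    (cong suc length-xs) (cfPLFT≡applyWord-cfWord q0 xs)
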